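{- Let $G$ be a finite simple graph with $\alpha(G)>|V(G)|/2$ and $\xi(G)=1$. Then $|V(G)|\equiv 1 \pmod 2$.
   Context: $\alpha(G)$ is the maximum size of a stable set; $\Omega(G)$ is the set of maximum stable sets; $core(G)=\bigcap\{S:S\in\Omega(G)\}$ and $\xi(G)=|core(G)|$. -}

module Defs where

open import Data.Nat using (ℕ; _≤_)
open import Data.Fin using (Fin)
open import Data.Fin.Subset using (Subset; _∈_; ∣_∣)
open import Data.Product using (Σ; _×_; ∃)
open import Relation.Nullary using (¬_; Dec)
open import Relation.Binary.PropositionalEquality using (_≡_)
open import Level using (0ℓ; suc)

record Graph (n : ℕ) : Set₁ where
  field
    Adj   : Fin n → Fin n → Set
    sym   : ∀ {i j} → Adj i j → Adj j i
    irrefl : ∀ {i} → ¬ Adj i i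
    dec   : ∀ i j → Dec (Adj i j)

open Graph public

Stable : ∀ {n} → Graph n → Subset n → Set
Stable G S = ∀ {i j} → i ∈ S → j ∈ S → ¬ Adj G i j

IsAlpha : ∀ {n} → Graph n → ℕ → Set
IsAlpha G k = (∃ λ S → Stable G S × ∣ S ∣ ≡ k) × (∀ S → Stable G S → ∣ S ∣ ≤ k)

IsMaximumStable : ∀ {n} → Graph n → Subset n → Set
IsMaximumStable G S = Stable G S × (∀ T → Stable G T → ∣ T ∣ ≤ ∣ S ∣)

InCore : ∀ {n} → Graph n → Fin n → Set
InCore G v = ∀ S → IsMaximumStable G S → v ∈ S

CoreSizeOne : ∀ {n} → Graph n → Set
CoreSizeOne G = ∃ λ v → InCore G v × (∀ w → InCore G w → w ≡ v)

{-# OPTIONS --safe #-}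

-- For a stable set A write d(A) = ∣A∣ − ∣N(A)∣. If S is a maximum stable set, then
-- (S ∖ N(A)) ∪ A is stable, hence no larger than S, so ∣A ∖ S∣ ≤ ∣S ∩ N(A)∣; as N(A ∩ S)
-- lies in N(A) ∖ S, this gives d(A ∩ S) ≥ d(A). Starting from a maximum stable set, where
-- d ≥ 2α − n, and replacing A by A ∩ S whenever a maximum stable set S misses a vertex of A,
-- one ends inside the core; hence ξ(G) ≥ 2α − n. With ξ(G) = 1 and 2α > n this forces n = 2α − 1.

module Submission where

open import Defs
open import Data.Nat using (ℕ; _<_; _*_; _%_)
open import Relation.Binary.PropositionalEquality using (_≡_)

open import Data.Bool using (true; false)
open import Data.Empty using (⊥-elim)
open import Data.Fin using (Fin)
open import Data.Fin.Properties using (any?)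
open import Data.Fin.Subset
  using (Subset; _∈_; ∣_∣; ⊤; ⁅_⁆; _∉_; _⊆_; _⊂_; ∁; _∩_; _∪_)
open import Data.Fin.Subset.Induction using (⊂-wellFounded)
open import Data.Fin.Subset.Properties
  using ( _∈?_; ∈⊤; ∣⊤∣≡n; x∈⁅x⁆; ∣⁅x⁆∣≡1; p⊆q⇒∣p∣≤∣q∣; ∩-comm; ∩-identityˡ
        ; p∩q⊆p; p∩q⊆q; x∈p∩q⁺; x∈p∪q⁻; x∈∁p⇒x∉p; x∉p⇒x∈∁p )
open import Data.Nat using (suc; _+_; _≤_; _≤?_)
open import Data.Nat.DivMod using ([m+kn]%n≡m%n)
open import Data.Nat.Properties
open import Algebra.Properties.CommutativeSemigroup +-commutativeSemigroup
  using (xy∙z≈x∙zy; x∙yz≈xz∙y; xy∙z≈xz∙y)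
open import Data.Product using (∃; _×_; _,_)
open import Data.Sum using (inj₁; inj₂)
open import Data.Vec using ([]; _∷_; tabulate)
open import Data.Vec.Properties using (lookup∘tabulate; lookup⇒[]=; []=⇒lookup)
open import Induction.WellFounded using (Acc; acc)
open import Relation.Binary.PropositionalEquality
  using (refl; trans; cong; subst; module ≡-Reasoning) renaming (sym to ≡-sym)
open import Relation.Nullary using (¬_; Dec; does; yes; no; _×-dec_)
open import Relation.Nullary.Decidable using (dec-true; decidable-stable)

private
  variable
    n : ℕ

-- A lower bound m − a on a surplus x − y is written m + y ≤ a + x, avoiding truncated subtraction.
surplus-trans : ∀ m a {x y x′ y′} → m + y ≤ a + x → x + y′ ≤ x′ + y → m + y′ ≤ a + x′
surplus-trans m a {x} {y} {x′} {y′} h h′ = +-cancelʳ-≤ x _ _ (begin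
  m + y′ + x   ≡⟨ xy∙z≈x∙zy m y′ x ⟩
  m + (x + y′) ≤⟨ +-monoʳ-≤ m h′ ⟩
  m + (x′ + y) ≡⟨ x∙yz≈xz∙y m x′ y ⟩
  m + y + x′   ≤⟨ +-monoˡ-≤ x′ h ⟩
  a + x + x′   ≡⟨ xy∙z≈xz∙y a x x′ ⟩
  a + x′ + x   ∎)
  where open ≤-Reasoning

∣p∪q∣+∣p∩q∣≡∣p∣+∣q∣ : ∀ (p q : Subset n) → ∣ p ∪ q ∣ + ∣ p ∩ q ∣ ≡ ∣ p ∣ + ∣ q ∣
∣p∪q∣+∣p∩q∣≡∣p∣+∣q∣ []          []          = refl
∣p∪q∣+∣p∩q∣≡∣p∣+∣q∣ (true  ∷ p) (true  ∷ q) = cong suc (begin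
  ∣ p ∪ q ∣ + suc ∣ p ∩ q ∣   ≡⟨ +-suc _ _ ⟩
  suc (∣ p ∪ q ∣ + ∣ p ∩ q ∣) ≡⟨ cong suc (∣p∪q∣+∣p∩q∣≡∣p∣+∣q∣ p q) ⟩
  suc (∣ p ∣ + ∣ q ∣)         ≡⟨ +-suc _ _ ⟨
  ∣ p ∣ + suc ∣ q ∣           ∎)
  where open ≡-Reasoning
∣p∪q∣+∣p∩q∣≡∣p∣+∣q∣ (true  ∷ p) (false ∷ q) = cong suc (∣p∪q∣+∣p∩q∣≡∣p∣+∣q∣ p q)
∣p∪q∣+∣p∩q∣≡∣p∣+∣q∣ (false ∷ p) (true  ∷ q) =
  trans (cong suc (∣p∪q∣+∣p∩q∣≡∣p∣+∣q∣ p q)) (≡-sym (+-suc _ _))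
∣p∪q∣+∣p∩q∣≡∣p∣+∣q∣ (false ∷ p) (false ∷ q) = ∣p∪q∣+∣p∩q∣≡∣p∣+∣q∣ p q

∣p∩∁q∣+∣p∩q∣≡∣p∣ : ∀ (p q : Subset n) → ∣ p ∩ ∁ q ∣ + ∣ p ∩ q ∣ ≡ ∣ p ∣
∣p∩∁q∣+∣p∩q∣≡∣p∣ []          []          = refl
∣p∩∁q∣+∣p∩q∣≡∣p∣ (true  ∷ p) (true  ∷ q) = trans (+-suc _ _) (cong suc (∣p∩∁q∣+∣p∩q∣≡∣p∣ p q))
∣p∩∁q∣+∣p∩q∣≡∣p∣ (true  ∷ p) (false ∷ q) = cong suc (∣p∩∁q∣+∣p∩q∣≡∣p∣ p q)
∣p∩∁q∣+∣p∩q∣≡∣p∣ (false ∷ p) (_     ∷ q) = ∣p∩∁q∣+∣p∩q∣≡∣p∣ p q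

p⊆q∩∁r⇒∣p∣+∣q∩r∣≤∣q∣ : ∀ {p q r : Subset n} → p ⊆ q ∩ ∁ r → ∣ p ∣ + ∣ q ∩ r ∣ ≤ ∣ q ∣
p⊆q∩∁r⇒∣p∣+∣q∩r∣≤∣q∣ {p = p} {q} {r} p⊆q∖r = begin
  ∣ p ∣ + ∣ q ∩ r ∣       ≤⟨ +-monoˡ-≤ _ (p⊆q⇒∣p∣≤∣q∣ p⊆q∖r) ⟩
  ∣ q ∩ ∁ r ∣ + ∣ q ∩ r ∣ ≡⟨ ∣p∩∁q∣+∣p∩q∣≡∣p∣ q r ⟩
  ∣ q ∣                   ∎
  where open ≤-Reasoning

∣q∩∁r∪p∣≤∣q∣⇒∣p∣≤∣p∩q∣+∣q∩r∣ : ∀ (p q r : Subset n) →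
  ∣ (q ∩ ∁ r) ∪ p ∣ ≤ ∣ q ∣ → ∣ p ∣ ≤ ∣ p ∩ q ∣ + ∣ q ∩ r ∣
∣q∩∁r∪p∣≤∣q∣⇒∣p∣≤∣p∩q∣+∣q∩r∣ p q r ∣q∖r∪p∣≤∣q∣ = +-cancelˡ-≤ (∣ q ∩ ∁ r ∣) _ _ (begin
  ∣ q ∩ ∁ r ∣ + ∣ p ∣                       ≡⟨ ∣p∪q∣+∣p∩q∣≡∣p∣+∣q∣ (q ∩ ∁ r) p ⟨
  ∣ (q ∩ ∁ r) ∪ p ∣ + ∣ (q ∩ ∁ r) ∩ p ∣     ≤⟨ +-mono-≤ ∣q∖r∪p∣≤∣q∣ (p⊆q⇒∣p∣≤∣q∣ q∖r∩p⊆p∩q) ⟩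
  ∣ q ∣ + ∣ p ∩ q ∣                         ≡⟨ cong (_+ ∣ p ∩ q ∣) (∣p∩∁q∣+∣p∩q∣≡∣p∣ q r) ⟨
  ∣ q ∩ ∁ r ∣ + ∣ q ∩ r ∣ + ∣ p ∩ q ∣       ≡⟨ xy∙z≈x∙zy (∣ q ∩ ∁ r ∣) (∣ q ∩ r ∣) (∣ p ∩ q ∣) ⟩
  ∣ q ∩ ∁ r ∣ + (∣ p ∩ q ∣ + ∣ q ∩ r ∣)     ∎)
  where
  open ≤-Reasoning
  q∖r∩p⊆p∩q : (q ∩ ∁ r) ∩ p ⊆ p ∩ q
  q∖r∩p⊆p∩q x∈ = x∈p∩q⁺ (p∩q⊆q _ p x∈ , p∩q⊆p q _ (p∩q⊆p _ p x∈))

satisfying : {P : Fin n → Set} → (∀ i → Dec (P i)) → Subset n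
satisfying P? = tabulate (λ i → does (P? i))

module _ {P : Fin n → Set} (P? : ∀ i → Dec (P i)) {i : Fin n} where

  ∈-satisfying⁺ : P i → i ∈ satisfying P?
  ∈-satisfying⁺ Pi = lookup⇒[]= i _ (trans (lookup∘tabulate _ i) (dec-true (P? i) Pi))

  ∈-satisfying⁻ : i ∈ satisfying P? → P i
  ∈-satisfying⁻ i∈ with P? i | trans (≡-sym (lookup∘tabulate _ i)) ([]=⇒lookup i∈)
  ... | yes Pi | _  = Pi
  ... | no _   | ()

module _ (G : Graph n) where

  adjacentTo? : ∀ A j → Dec (∃ λ i → i ∈ A × Adj G i j)
  adjacentTo? A j = any? (λ i → (i ∈? A) ×-dec dec G i j)

  N : Subset n → Subset n
  N A = satisfying (adjacentTo? A)

  module _ {A : Subset n} {j : Fin n} where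

    ∈N⁺ : ∀ {i} → i ∈ A → Adj G i j → j ∈ N A
    ∈N⁺ {i} i∈A i~j = ∈-satisfying⁺ (adjacentTo? A) (i , i∈A , i~j)

    ∈N⁻ : j ∈ N A → ∃ λ i → i ∈ A × Adj G i j
    ∈N⁻ = ∈-satisfying⁻ (adjacentTo? A)

  N-mono : ∀ {A B} → A ⊆ B → N A ⊆ N B
  N-mono A⊆B j∈NA with ∈N⁻ j∈NA
  ... | i , i∈A , i~j = ∈N⁺ (A⊆B i∈A) i~j

  stable⇒∉N : ∀ {A i} → Stable G A → i ∈ A → i ∉ N A
  stable⇒∉N stA i∈A i∈NA with ∈N⁻ i∈NA
  ... | j , j∈A , j~i = stA j∈A i∈A j~i

  stable-⊆ : ∀ {A B} → A ⊆ B → Stable G B → Stable G A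
  stable-⊆ A⊆B stB i∈A j∈A = stB (A⊆B i∈A) (A⊆B j∈A)

  stable-exchange : ∀ {A S} → Stable G A → Stable G S → Stable G ((S ∩ ∁ (N A)) ∪ A)
  stable-exchange {A} {S} stA stS i∈ j∈ i~j
    with x∈p∪q⁻ (S ∩ ∁ (N A)) A i∈ | x∈p∪q⁻ (S ∩ ∁ (N A)) A j∈
  ... | inj₂ i∈A    | inj₂ j∈A    = stA i∈A j∈A i~j
  ... | inj₁ i∈S∖NA | inj₁ j∈S∖NA = stS (p∩q⊆p S _ i∈S∖NA) (p∩q⊆p S _ j∈S∖NA) i~j
  ... | inj₁ i∈S∖NA | inj₂ j∈A    = x∈∁p⇒x∉p (p∩q⊆q S _ i∈S∖NA) (∈N⁺ j∈A (Graph.sym G i~j))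
  ... | inj₂ i∈A    | inj₁ j∈S∖NA = x∈∁p⇒x∉p (p∩q⊆q S _ j∈S∖NA) (∈N⁺ i∈A i~j)

  ∣A∣+∣N[A∩S]∣≤∣A∩S∣+∣N[A]∣ : ∀ {A S} → Stable G A → IsMaximumStable G S →
                             ∣ A ∣ + ∣ N (A ∩ S) ∣ ≤ ∣ A ∩ S ∣ + ∣ N A ∣
  ∣A∣+∣N[A∩S]∣≤∣A∩S∣+∣N[A]∣ {A} {S} stA (stS , S-maximum) = begin
    ∣ A ∣ + ∣ N (A ∩ S) ∣                     ≤⟨ +-monoˡ-≤ _ exchange ⟩
    ∣ A ∩ S ∣ + ∣ S ∩ N A ∣ + ∣ N (A ∩ S) ∣     ≡⟨ xy∙z≈x∙zy (∣ A ∩ S ∣) (∣ S ∩ N A ∣) (∣ N (A ∩ S) ∣) ⟩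
    ∣ A ∩ S ∣ + (∣ N (A ∩ S) ∣ + ∣ S ∩ N A ∣) ≤⟨ +-monoʳ-≤ (∣ A ∩ S ∣) boundary ⟩
    ∣ A ∩ S ∣ + ∣ N A ∣                       ∎
    where
    open ≤-Reasoning
    exchange : ∣ A ∣ ≤ ∣ A ∩ S ∣ + ∣ S ∩ N A ∣
    exchange = ∣q∩∁r∪p∣≤∣q∣⇒∣p∣≤∣p∩q∣+∣q∩r∣ A S (N A) (S-maximum _ (stable-exchange stA stS))
    N[A∩S]⊆N[A]∖S : N (A ∩ S) ⊆ N A ∩ ∁ S
    N[A∩S]⊆N[A]∖S x∈ = x∈p∩q⁺ ( N-mono (p∩q⊆p A S) x∈
                              , x∉p⇒x∈∁p (λ x∈S → stable⇒∉N stS x∈S (N-mono (p∩q⊆q A S) x∈)))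
    boundary : ∣ N (A ∩ S) ∣ + ∣ S ∩ N A ∣ ≤ ∣ N A ∣
    boundary = subst (λ k → ∣ N (A ∩ S) ∣ + k ≤ ∣ N A ∣) (cong ∣_∣ (∩-comm (N A) S))
                     (p⊆q∩∁r⇒∣p∣+∣q∩r∣≤∣q∣ N[A∩S]⊆N[A]∖S)

  ∣A∣+∣N[A]∣≤n : ∀ {A} → Stable G A → ∣ A ∣ + ∣ N A ∣ ≤ n
  ∣A∣+∣N[A]∣≤n {A} stA = begin
    ∣ A ∣ + ∣ N A ∣     ≡⟨ cong (λ B → ∣ A ∣ + ∣ B ∣) (∩-identityˡ (N A)) ⟨
    ∣ A ∣ + ∣ ⊤ ∩ N A ∣ ≤⟨ p⊆q∩∁r⇒∣p∣+∣q∩r∣≤∣q∣ (λ x∈A → x∈p∩q⁺ (∈⊤ , x∉p⇒x∈∁p (stable⇒∉N stA x∈A))) ⟩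
    ∣ ⊤ {n} ∣           ≡⟨ ∣⊤∣≡n n ⟩
    n                   ∎
    where open ≤-Reasoning

  module _ {K : Subset n} (core⊆K : ∀ v → InCore G v → v ∈ K) where

    surplus≤∣K∣ : ∀ {m a A} → Stable G A → m + ∣ N A ∣ ≤ a + ∣ A ∣ → m ≤ a + ∣ K ∣
    surplus≤∣K∣ {A = A} = go (⊂-wellFounded A)
      where
      -- The goal is decidable, so we may refute its negation; under it every vertex x of A is in
      -- the core, because a maximum stable set S missing x would make A ∩ S a smaller counterexample.
      go : ∀ {m a A} → Acc _⊂_ A → Stable G A → m + ∣ N A ∣ ≤ a + ∣ A ∣ → m ≤ a + ∣ K ∣
      go {m} {a} {A} (acc smaller) stA surplus = decidable-stable (m ≤? a + ∣ K ∣) λ m≰a+∣K∣ →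
        m≰a+∣K∣ (≤-trans (≤-trans (m≤m+n m _) surplus)
                          (+-monoʳ-≤ a (p⊆q⇒∣p∣≤∣q∣ (λ {x} x∈A → core⊆K x (in-core m≰a+∣K∣ x∈A)))))
        where
        in-core : ¬ m ≤ a + ∣ K ∣ → ∀ {x} → x ∈ A → InCore G x
        in-core m≰a+∣K∣ {x} x∈A S S-maximum with x ∈? S
        ... | yes x∈S = x∈S
        ... | no  x∉S = ⊥-elim (m≰a+∣K∣ (go (smaller A∩S⊂A) (stable-⊆ (p∩q⊆p A S) stA)
                          (surplus-trans m a surplus (∣A∣+∣N[A∩S]∣≤∣A∩S∣+∣N[A]∣ stA S-maximum))))
          where
          A∩S⊂A : A ∩ S ⊂ A
          A∩S⊂A = p∩q⊆p A S , x , x∈A , λ x∈A∩S → x∉S (p∩q⊆q A S x∈A∩S)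

    2*α≤n+∣K∣ : ∀ {α} → IsAlpha G α → 2 * α ≤ n + ∣ K ∣
    2*α≤n+∣K∣ {α} ((S , stS , ∣S∣≡α) , _) = surplus≤∣K∣ stS (begin
      2 * α + ∣ N S ∣     ≡⟨ cong (λ k → α + k + ∣ N S ∣) (+-identityʳ α) ⟩
      α + α + ∣ N S ∣     ≡⟨ +-assoc α α (∣ N S ∣) ⟩
      α + (α + ∣ N S ∣)   ≤⟨ +-monoʳ-≤ α (subst (λ k → k + ∣ N S ∣ ≤ n) ∣S∣≡α (∣A∣+∣N[A]∣≤n stS)) ⟩
      α + n               ≡⟨ +-comm α n ⟩
      n + α               ≡⟨ cong (n +_) ∣S∣≡α ⟨
      n + ∣ S ∣           ∎)
      where open ≤-Reasoning

2*α≡1+n⇒n%2≡1 : ∀ {n} α → 2 * α ≡ suc n → n % 2 ≡ 1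
2*α≡1+n⇒n%2≡1 {n} (suc β) 2α≡1+n = begin
  n % 2           ≡⟨ cong (_% 2) n≡1+β*2 ⟩
  (1 + β * 2) % 2 ≡⟨ [m+kn]%n≡m%n 1 β 2 ⟩
  1               ∎
  where
  open ≡-Reasoning
  n≡1+β*2 : n ≡ 1 + β * 2
  n≡1+β*2 = suc-injective (trans (≡-sym 2α≡1+n) (trans (*-suc 2 β) (cong (2 +_) (*-comm 2 β))))

corollary4 : (n : ℕ) (G : Graph n) (α : ℕ) → IsAlpha G α → n < 2 * α → CoreSizeOne G → n % 2 ≡ 1
corollary4 n G α α-spec n<2α (v , _ , core≡v) = 2*α≡1+n⇒n%2≡1 α (≤-antisym 2α≤1+n n<2α)
  where
  open ≤-Reasoning
  core⊆⁅v⁆ : ∀ w → InCore G w → w ∈ ⁅ v ⁆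
  core⊆⁅v⁆ w w∈core = subst (_∈ ⁅ v ⁆) (≡-sym (core≡v w w∈core)) (x∈⁅x⁆ v)
  2α≤1+n : 2 * α ≤ suc n
  2α≤1+n = begin
    2 * α         ≤⟨ 2*α≤n+∣K∣ G core⊆⁅v⁆ α-spec ⟩
    n + ∣ ⁅ v ⁆ ∣ ≡⟨ cong (n +_) (∣⁅x⁆∣≡1 v) ⟩
    n + 1         ≡⟨ +-comm n 1 ⟩
    suc n         ∎
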